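{- The operad PAN, generated by one binary operation $\leftharpoondown$ (with no symmetry) subject to the relations $x\leftharpoondown(y\leftharpoondown z)=0$ and $(x\leftharpoondown y)\leftharpoondown z=(x\leftharpoondown z)\leftharpoondown y$, is the Koszul dual operad of the operad NAP, generated by one binary operation $\cdot$ (with no symmetry) subject to the relation $(x\cdot y)\cdot z=(x\cdot z)\cdot y$.
   Context: Koszul duality of binary quadratic operads in the sense of Ginzburg–Kapranov: for a quadratic operad $\mathcal{P}=\mathcal{F}(E)/(R)$ generated by binary operations $E$, the Koszul dual is $\mathcal{P}^!=\mathcal{F}(E^\vee)/(R^\perp)$ with $E^\vee=E^*\otimes\mathrm{sgn}$ and $R^\perp$ the orthogonal of $R$ under the standard pairing on the arity-3 part of the free operad. -}

module Defs where

open import Level using (Level; _⊔_; suc)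
open import Algebra.Bundles using (CommutativeRing)
open import Data.Product using (Σ; _×_)
open import Relation.Nullary using (¬_)

-- Fields (agda-stdlib has no Field bundle): a nontrivial commutative
-- ring in which every nonzero element has a multiplicative inverse.

record Field (c ℓ : Level) : Set (suc (c ⊔ ℓ)) where
  field
    commutativeRing : CommutativeRing c ℓ
  open CommutativeRing commutativeRing public
  field
    0≉1     : ¬ (0# ≈ 1#)
    inverse : ∀ x → ¬ (x ≈ 0#) → Σ Carrier (λ y → x * y ≈ 1#)

-- The symmetric group S₃, each element σ recorded by the ordered triple
-- of its images (σ 0, σ 1, σ 2).

data S3 : Set where
  e₀₁₂ e₁₀₂ e₀₂₁ e₂₁₀ e₁₂₀ e₂₀₁ : S3

data Sign : Set where
  plus minus : Sign

sign : S3 → Sign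
sign e₀₁₂ = plus
sign e₁₀₂ = minus
sign e₀₂₁ = minus
sign e₂₁₀ = minus
sign e₁₂₀ = plus
sign e₂₀₁ = plus

-- σ ↦ σ ∘ (1 2)  : swaps the last two entries of the triple (σ0,σ1,σ2)
swapTail : S3 → S3
swapTail e₀₁₂ = e₀₂₁
swapTail e₁₀₂ = e₁₂₀
swapTail e₀₂₁ = e₀₁₂
swapTail e₂₁₀ = e₂₀₁
swapTail e₁₂₀ = e₁₀₂
swapTail e₂₀₁ = e₂₁₀

-- Arity-3 component of the free operad on one binary operation with no
-- symmetry (E = k[S₂]).  Its 12 basis monomials are
--   (L , σ)  ↔  (x_{σ0} x_{σ1}) x_{σ2}      (left combs)
--   (R , σ)  ↔  x_{σ0} (x_{σ1} x_{σ2})      (right combs)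

data Shape : Set where
  L R : Shape

module Quadratic {c ℓ : Level} (F : Field c ℓ) where
  open Field F

  V3 : Set c
  V3 = Shape → S3 → Carrier

  _≈V_ : V3 → V3 → Set ℓ
  u ≈V v = ∀ sh σ → u sh σ ≈ v sh σ

  0V : V3
  0V _ _ = 0#

  _+V_ : V3 → V3 → V3
  (u +V v) sh σ = u sh σ + v sh σ

  _-V_ : V3 → V3 → V3
  (u -V v) sh σ = u sh σ + (- v sh σ)

  _·V_ : Carrier → V3 → V3
  (a ·V v) sh σ = a * v sh σ

  ΣS3 : (S3 → Carrier) → Carrier
  ΣS3 f = f e₀₁₂ + (f e₁₀₂ + (f e₀₂₁ + (f e₂₁₀ + (f e₁₂₀ + f e₂₀₁))))

  ΣS3V : (S3 → V3) → V3
  ΣS3V f sh σ = ΣS3 (λ τ → f τ sh σ)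

  δS : Shape → Shape → Carrier
  δS L L = 1#
  δS R R = 1#
  δS _ _ = 0#

  δ : S3 → S3 → Carrier
  δ e₀₁₂ e₀₁₂ = 1#
  δ e₁₀₂ e₁₀₂ = 1#
  δ e₀₂₁ e₀₂₁ = 1#
  δ e₂₁₀ e₂₁₀ = 1#
  δ e₁₂₀ e₁₂₀ = 1#
  δ e₂₀₁ e₂₀₁ = 1#
  δ _ _ = 0#

  mon : Shape → S3 → V3
  mon sh σ sh' σ' = δS sh sh' * δ σ σ'

  sgn : S3 → Carrier
  sgn σ with sign σ
  ... | plus  = 1#
  ... | minus = - 1#

  -- The standard (Ginzburg–Kapranov) pairing
  --   F(E)(3) ⊗ F(E^∨)(3) → k,
  -- written in the basis of monomials after the identification
  -- E^∨ ≅ E, μ* ↦ μ: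
  --   ⟨(x_{σ0}x_{σ1})x_{σ2}, (x_{σ0}x_{σ1})x_{σ2}⟩ =  sgn σ
  --   ⟨x_{σ0}(x_{σ1}x_{σ2}), x_{σ0}(x_{σ1}x_{σ2})⟩ = -sgn σ
  -- and all other pairings of monomials are 0.
  ⟨_,_⟩ : V3 → V3 → Carrier
  ⟨ u , v ⟩ = ΣS3 (λ σ → sgn σ * (u L σ * v L σ) + (- (sgn σ * (u R σ * v R σ))))

  -- Relations.  The S₃-submodule generated by a relation r(x0,x1,x2)
  -- is the linear span of its substitution instances r(x_{σ0},x_{σ1},x_{σ2}).

  -- NAP :  (x·y)·z − (x·z)·y
  napRel : S3 → V3
  napRel σ = mon L σ -V mon L (swapTail σ)

  -- PAN :  x↼(y↼z)   and   (x↼y)↼z − (x↼z)↼y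
  panRel₁ : S3 → V3
  panRel₁ σ = mon R σ

  panRel₂ : S3 → V3
  panRel₂ σ = mon L σ -V mon L (swapTail σ)

  InRNAP : V3 → Set (c ⊔ ℓ)
  InRNAP v = Σ (S3 → Carrier) λ a → v ≈V ΣS3V (λ σ → a σ ·V napRel σ)

  InRPAN : V3 → Set (c ⊔ ℓ)
  InRPAN v = Σ (S3 → Carrier) λ a → Σ (S3 → Carrier) λ b →
    v ≈V ΣS3V (λ σ → (a σ ·V panRel₁ σ) +V (b σ ·V panRel₂ σ))

  InRNAP⊥ : V3 → Set (c ⊔ ℓ)
  InRNAP⊥ v = ∀ w → InRNAP w → ⟨ w , v ⟩ ≈ 0#

-- Pairing against the NAP relation τ ↦ mon L τ - mon L (swapTail τ) only sees the left-comb
-- coordinates y = v L of v, and gives sgn τ · (y τ + y (swapTail τ)), because swapTail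
-- reverses the sign.  So v ⊥ R_NAP iff y is antisymmetric under swapTail.  The PAN relations
-- span all right combs together with the left-comb vectors of the form b - b ∘ swapTail, and
-- these are exactly the antisymmetric y: every swapTail-orbit {σ, swapTail σ} contains one
-- even permutation, so b can be taken to be y on even and 0 on odd permutations.
module Submission where

open import Defs
open import Level using (Level)
open import Data.Fin using (#_)
open import Data.Product using (_,_)
open import Data.Vec using ([]; _∷_)
open import Function.Base using (_∘_)
open import Function.Bundles using (_⇔_; mk⇔)
import Function.Properties.Equivalence as ⇔
open import Relation.Binary.PropositionalEquality as ≡ using (_≡_)
import Algebra.Properties.Ring as RingProperties
import Algebra.Properties.CommutativeSemigroup as CommutativeSemigroupProperties
import Algebra.Solver.CommutativeMonoid as CommutativeMonoidSolver
import Relation.Binary.Reasoning.Setoid as SetoidReasoning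

swapTail-involutive : ∀ σ → swapTail (swapTail σ) ≡ σ
swapTail-involutive e₀₁₂ = ≡.refl
swapTail-involutive e₁₀₂ = ≡.refl
swapTail-involutive e₀₂₁ = ≡.refl
swapTail-involutive e₂₁₀ = ≡.refl
swapTail-involutive e₁₂₀ = ≡.refl
swapTail-involutive e₂₀₁ = ≡.refl

module _ {c ℓ : Level} (F : Field c ℓ) where
  open Field F
  open Quadratic F
  open RingProperties ring
  open CommutativeSemigroupProperties +-commutativeSemigroup using (interchange)
  open SetoidReasoning setoid

  sgn-swapTail : ∀ σ → sgn (swapTail σ) ≈ - sgn σ
  sgn-swapTail e₀₁₂ = refl
  sgn-swapTail e₁₀₂ = sym (-‿involutive 1#)
  sgn-swapTail e₀₂₁ = sym (-‿involutive 1#)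
  sgn-swapTail e₂₁₀ = sym (-‿involutive 1#)
  sgn-swapTail e₁₂₀ = refl
  sgn-swapTail e₂₀₁ = refl

  sgn-square : ∀ σ → sgn σ * sgn σ ≈ 1#
  sgn-square σ with sign σ
  ... | plus  = *-identityʳ 1#
  ... | minus = trans (-1*x≈-x (- 1#)) (-‿involutive 1#)

  sgn-cancel : ∀ σ {x} → sgn σ * x ≈ 0# → x ≈ 0#
  sgn-cancel σ {x} sx≈0 = begin
    x                     ≈⟨ *-identityˡ x ⟨
    1# * x                ≈⟨ *-congʳ (sgn-square σ) ⟨
    sgn σ * sgn σ * x     ≈⟨ *-assoc (sgn σ) (sgn σ) x ⟩
    sgn σ * (sgn σ * x)   ≈⟨ *-congˡ sx≈0 ⟩
    sgn σ * 0#            ≈⟨ zeroʳ (sgn σ) ⟩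
    0#                    ∎

  ΣS3-cong : ∀ {f g : S3 → Carrier} → (∀ τ → f τ ≈ g τ) → ΣS3 f ≈ ΣS3 g
  ΣS3-cong f≈g = +-cong (f≈g e₀₁₂) (+-cong (f≈g e₁₀₂) (+-cong (f≈g e₀₂₁)
                   (+-cong (f≈g e₂₁₀) (+-cong (f≈g e₁₂₀) (f≈g e₂₀₁)))))

  ΣS3-zero : ∀ {f : S3 → Carrier} → (∀ τ → f τ ≈ 0#) → ΣS3 f ≈ 0#
  ΣS3-zero f≈0 = trans (ΣS3-cong f≈0) (zero+ (zero+ (zero+ (zero+ (+-identityʳ 0#)))))
    where
    zero+ : ∀ {x} → x ≈ 0# → 0# + x ≈ 0#
    zero+ {x} x≈0 = trans (+-identityˡ x) x≈0

  ΣS3-+ : ∀ (f g : S3 → Carrier) → ΣS3 (λ τ → f τ + g τ) ≈ ΣS3 f + ΣS3 g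
  ΣS3-+ f g =
    trans (+-congˡ (+-congˡ (+-congˡ (+-congˡ (interchange (f e₁₂₀) (g e₁₂₀) (f e₂₀₁) (g e₂₀₁))))))
    (trans (+-congˡ (+-congˡ (+-congˡ (interchange (f e₂₁₀) (g e₂₁₀) _ _))))
    (trans (+-congˡ (+-congˡ (interchange (f e₀₂₁) (g e₀₂₁) _ _)))
    (trans (+-congˡ (interchange (f e₁₀₂) (g e₁₀₂) _ _))
    (interchange (f e₀₁₂) (g e₀₁₂) _ _))))

  ΣS3-swapTail : ∀ (f : S3 → Carrier) → ΣS3 (f ∘ swapTail) ≈ ΣS3 f
  ΣS3-swapTail f =
    prove 6 (x₀₂₁ ⊕ (x₁₂₀ ⊕ (x₀₁₂ ⊕ (x₂₀₁ ⊕ (x₁₀₂ ⊕ x₂₁₀)))))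
            (x₀₁₂ ⊕ (x₁₀₂ ⊕ (x₀₂₁ ⊕ (x₂₁₀ ⊕ (x₁₂₀ ⊕ x₂₀₁)))))
            (f e₀₁₂ ∷ f e₁₀₂ ∷ f e₀₂₁ ∷ f e₂₁₀ ∷ f e₁₂₀ ∷ f e₂₀₁ ∷ [])
    where
    open CommutativeMonoidSolver +-commutativeMonoid
    x₀₁₂ = var (# 0)
    x₁₀₂ = var (# 1)
    x₀₂₁ = var (# 2)
    x₂₁₀ = var (# 3)
    x₁₂₀ = var (# 4)
    x₂₀₁ = var (# 5)

  ΣS3-δ : ∀ (f : S3 → Carrier) σ → ΣS3 (λ τ → f τ * δ τ σ) ≈ f σ
  ΣS3-δ f = sift
    where
    skip : ∀ x {y z} → y ≈ z → x * 0# + y ≈ z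
    skip x {y} y≈z = trans (+-congʳ (zeroʳ x)) (trans (+-identityˡ y) y≈z)
    only : ∀ x {y} → y ≈ 0# → x * 1# + y ≈ x
    only x y≈0 = trans (+-cong (*-identityʳ x) y≈0) (+-identityʳ x)
    sift : ∀ σ → ΣS3 (λ τ → f τ * δ τ σ) ≈ f σ
    sift e₀₁₂ = only _ (skip _ (skip _ (skip _ (skip _ (zeroʳ _)))))
    sift e₁₀₂ = skip _ (only _ (skip _ (skip _ (skip _ (zeroʳ _)))))
    sift e₀₂₁ = skip _ (skip _ (only _ (skip _ (skip _ (zeroʳ _)))))
    sift e₂₁₀ = skip _ (skip _ (skip _ (only _ (skip _ (zeroʳ _)))))
    sift e₁₂₀ = skip _ (skip _ (skip _ (skip _ (only _ (zeroʳ _)))))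
    sift e₂₀₁ = skip _ (skip _ (skip _ (skip _ (skip _ (*-identityʳ _)))))

  ΣS3-δ-swapTail : ∀ (f : S3 → Carrier) σ → ΣS3 (λ τ → f τ * δ (swapTail τ) σ) ≈ f (swapTail σ)
  ΣS3-δ-swapTail f σ = begin
    ΣS3 (λ τ → f τ * δ (swapTail τ) σ)
      ≈⟨ ΣS3-swapTail (λ τ → f τ * δ (swapTail τ) σ) ⟨
    ΣS3 (λ τ → f (swapTail τ) * δ (swapTail (swapTail τ)) σ)
      ≈⟨ ΣS3-cong involution ⟩
    ΣS3 (λ τ → f (swapTail τ) * δ τ σ)
      ≈⟨ ΣS3-δ (f ∘ swapTail) σ ⟩
    f (swapTail σ) ∎
    where
    involution : ∀ τ → f (swapTail τ) * δ (swapTail (swapTail τ)) σ ≈ f (swapTail τ) * δ τ σ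
    involution τ = *-congˡ (reflexive (≡.cong (λ π → δ π σ) (swapTail-involutive τ)))

  TailAntisymmetric : (S3 → Carrier) → Set ℓ
  TailAntisymmetric y = ∀ σ → y σ + y (swapTail σ) ≈ 0#

  TailAntisymmetric-resp : ∀ {y y'} → (∀ σ → y σ ≈ y' σ) → TailAntisymmetric y' → TailAntisymmetric y
  TailAntisymmetric-resp y≈y' anti σ = trans (+-cong (y≈y' σ) (y≈y' (swapTail σ))) (anti σ)

  tailDifference-antisymmetric : ∀ (b : S3 → Carrier) → TailAntisymmetric (λ σ → b σ - b (swapTail σ))
  tailDifference-antisymmetric b σ = begin
    (b σ - b σ') + (b σ' - b (swapTail σ'))
      ≈⟨ +-congˡ (+-congˡ (-‿cong (reflexive (≡.cong b (swapTail-involutive σ))))) ⟩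
    (b σ - b σ') + (b σ' - b σ)     ≈⟨ +-congˡ (⁻¹-anti-homo‿- (b σ) (b σ')) ⟨
    (b σ - b σ') - (b σ - b σ')     ≈⟨ -‿inverseʳ (b σ - b σ') ⟩
    0#                              ∎
    where σ' = swapTail σ

  evenPart : (S3 → Carrier) → S3 → Carrier
  evenPart y σ with sign σ
  ... | plus  = y σ
  ... | minus = 0#

  antisymmetric⇒evenPart-difference : ∀ {y} → TailAntisymmetric y →
    ∀ σ → y σ ≈ evenPart y σ - evenPart y (swapTail σ)
  antisymmetric⇒evenPart-difference {y} anti = split
    where
    minus-zero : ∀ {x} → x ≈ x - 0#
    minus-zero {x} = sym (trans (+-congˡ -0#≈0#) (+-identityʳ x))
    zero-minus : ∀ {x x'} → x' + x ≈ 0# → x ≈ 0# - x'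
    zero-minus {x} {x'} x'+x≈0 = trans (+-inverseʳ-unique x' x x'+x≈0) (sym (+-identityˡ (- x')))
    split : ∀ σ → y σ ≈ evenPart y σ - evenPart y (swapTail σ)
    split e₀₁₂ = minus-zero
    split e₁₀₂ = zero-minus (anti e₁₂₀)
    split e₀₂₁ = zero-minus (anti e₀₁₂)
    split e₂₁₀ = zero-minus (anti e₂₀₁)
    split e₁₂₀ = minus-zero
    split e₂₀₁ = minus-zero

  napCombination : (S3 → Carrier) → V3
  napCombination e = ΣS3V (λ τ → e τ ·V napRel τ)

  panCombination : (S3 → Carrier) → (S3 → Carrier) → V3
  panCombination a b = ΣS3V (λ τ → (a τ ·V panRel₁ τ) +V (b τ ·V panRel₂ τ))

  napCombination-L : ∀ e σ → napCombination e L σ ≈ e σ - e (swapTail σ)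
  napCombination-L e σ = begin
    ΣS3 (λ τ → e τ * (1# * δ τ σ - 1# * δ (swapTail τ) σ))
      ≈⟨ ΣS3-cong distribute ⟩
    ΣS3 (λ τ → e τ * δ τ σ - e τ * δ (swapTail τ) σ)
      ≈⟨ ΣS3-+ (λ τ → e τ * δ τ σ) (λ τ → - (e τ * δ (swapTail τ) σ)) ⟩
    ΣS3 (λ τ → e τ * δ τ σ) + ΣS3 (λ τ → - (e τ * δ (swapTail τ) σ))
      ≈⟨ +-congˡ (ΣS3-cong negate) ⟩
    ΣS3 (λ τ → e τ * δ τ σ) + ΣS3 (λ τ → - e τ * δ (swapTail τ) σ)
      ≈⟨ +-cong (ΣS3-δ e σ) (ΣS3-δ-swapTail (-_ ∘ e) σ) ⟩
    e σ - e (swapTail σ) ∎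
    where
    distribute : ∀ τ → e τ * (1# * δ τ σ - 1# * δ (swapTail τ) σ)
                       ≈ e τ * δ τ σ - e τ * δ (swapTail τ) σ
    distribute τ = trans (*-congˡ (+-cong (*-identityˡ _) (-‿cong (*-identityˡ _))))
                         (x[y-z]≈xy-xz (e τ) _ _)
    negate : ∀ τ → - (e τ * δ (swapTail τ) σ) ≈ - e τ * δ (swapTail τ) σ
    negate τ = -‿distribˡ-* (e τ) _

  napCombination-R : ∀ e σ → napCombination e R σ ≈ 0#
  napCombination-R e σ = ΣS3-zero vanish
    where
    vanish : ∀ τ → e τ * (0# * δ τ σ - 0# * δ (swapTail τ) σ) ≈ 0#
    vanish τ = trans (*-congˡ (trans (+-cong (zeroˡ _) (-‿cong (zeroˡ _))) (-‿inverseʳ 0#)))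
                     (zeroʳ (e τ))

  panCombination-L : ∀ a b σ → panCombination a b L σ ≈ b σ - b (swapTail σ)
  panCombination-L a b σ =
    trans (ΣS3-+ (λ τ → a τ * (0# * δ τ σ)) (λ τ → b τ * napRel τ L σ))
      (trans (+-congʳ (ΣS3-zero vanish)) (trans (+-identityˡ _) (napCombination-L b σ)))
    where
    vanish : ∀ τ → a τ * (0# * δ τ σ) ≈ 0#
    vanish τ = trans (*-congˡ (zeroˡ _)) (zeroʳ (a τ))

  panCombination-R : ∀ a b σ → panCombination a b R σ ≈ a σ
  panCombination-R a b σ =
    trans (ΣS3-+ (λ τ → a τ * (1# * δ τ σ)) (λ τ → b τ * napRel τ R σ))
      (trans (+-congˡ (napCombination-R b σ))
      (trans (+-identityʳ _) (trans (ΣS3-cong unit) (ΣS3-δ a σ))))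
    where
    unit : ∀ τ → a τ * (1# * δ τ σ) ≈ a τ * δ τ σ
    unit τ = *-congˡ (*-identityˡ _)

  ⟨⟩-congˡ : ∀ {w w'} v → w ≈V w' → ⟨ w , v ⟩ ≈ ⟨ w' , v ⟩
  ⟨⟩-congˡ {w} {w'} v w≈w' = ΣS3-cong termwise
    where
    termwise : ∀ σ → sgn σ * (w L σ * v L σ) - sgn σ * (w R σ * v R σ)
                     ≈ sgn σ * (w' L σ * v L σ) - sgn σ * (w' R σ * v R σ)
    termwise σ = +-cong (*-congˡ (*-congʳ (w≈w' L σ))) (-‿cong (*-congˡ (*-congʳ (w≈w' R σ))))

  ⟨⟩-leftCombs : ∀ w v → (∀ σ → w R σ ≈ 0#) → ⟨ w , v ⟩ ≈ ΣS3 (λ σ → sgn σ * (w L σ * v L σ))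
  ⟨⟩-leftCombs w v wR≈0 = ΣS3-cong termwise
    where
    termwise : ∀ σ → sgn σ * (w L σ * v L σ) - sgn σ * (w R σ * v R σ) ≈ sgn σ * (w L σ * v L σ)
    termwise σ = trans (+-congˡ right-vanishes) (+-identityʳ _)
      where
      right-vanishes : - (sgn σ * (w R σ * v R σ)) ≈ 0#
      right-vanishes =
        trans (-‿cong (trans (*-congˡ (trans (*-congʳ (wR≈0 σ)) (zeroˡ _))) (zeroʳ _))) -0#≈0#

  ⟨napCombination⟩ : ∀ e v →
    ⟨ napCombination e , v ⟩ ≈ ΣS3 (λ σ → sgn σ * (v L σ + v L (swapTail σ)) * e σ)
  ⟨napCombination⟩ e v = begin
    ⟨ napCombination e , v ⟩
      ≈⟨ ⟨⟩-leftCombs (napCombination e) v (napCombination-R e) ⟩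
    ΣS3 (λ σ → sgn σ * (napCombination e L σ * y σ))
      ≈⟨ ΣS3-cong expand ⟩
    ΣS3 (λ σ → sgn σ * y σ * e σ - sgn σ * y σ * e (swapTail σ))
      ≈⟨ ΣS3-+ (λ σ → sgn σ * y σ * e σ) (λ σ → - (sgn σ * y σ * e (swapTail σ))) ⟩
    ΣS3 (λ σ → sgn σ * y σ * e σ) + ΣS3 (λ σ → - (sgn σ * y σ * e (swapTail σ)))
      ≈⟨ +-congˡ (ΣS3-swapTail (λ σ → - (sgn σ * y σ * e (swapTail σ)))) ⟨
    ΣS3 (λ σ → sgn σ * y σ * e σ)
      + ΣS3 (λ σ → - (sgn (swapTail σ) * y (swapTail σ) * e (swapTail (swapTail σ))))
      ≈⟨ +-congˡ (ΣS3-cong reflect) ⟩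
    ΣS3 (λ σ → sgn σ * y σ * e σ) + ΣS3 (λ σ → sgn σ * y (swapTail σ) * e σ)
      ≈⟨ ΣS3-+ (λ σ → sgn σ * y σ * e σ) (λ σ → sgn σ * y (swapTail σ) * e σ) ⟨
    ΣS3 (λ σ → sgn σ * y σ * e σ + sgn σ * y (swapTail σ) * e σ)
      ≈⟨ ΣS3-cong collect ⟩
    ΣS3 (λ σ → sgn σ * (y σ + y (swapTail σ)) * e σ) ∎
    where
    y = v L
    expand : ∀ σ → sgn σ * (napCombination e L σ * y σ)
                   ≈ sgn σ * y σ * e σ - sgn σ * y σ * e (swapTail σ)
    expand σ = begin
      sgn σ * (napCombination e L σ * y σ)     ≈⟨ *-congˡ (*-congʳ (napCombination-L e σ)) ⟩
      sgn σ * ((e σ - e (swapTail σ)) * y σ)   ≈⟨ *-congˡ (*-comm _ (y σ)) ⟩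
      sgn σ * (y σ * (e σ - e (swapTail σ)))   ≈⟨ *-assoc (sgn σ) (y σ) _ ⟨
      sgn σ * y σ * (e σ - e (swapTail σ))     ≈⟨ x[y-z]≈xy-xz (sgn σ * y σ) _ _ ⟩
      sgn σ * y σ * e σ - sgn σ * y σ * e (swapTail σ) ∎
    collect : ∀ σ → sgn σ * y σ * e σ + sgn σ * y (swapTail σ) * e σ
                    ≈ sgn σ * (y σ + y (swapTail σ)) * e σ
    collect σ = trans (sym (distribʳ (e σ) _ _)) (*-congʳ (sym (distribˡ (sgn σ) _ _)))
    reflect : ∀ σ → - (sgn (swapTail σ) * y (swapTail σ) * e (swapTail (swapTail σ)))
                    ≈ sgn σ * y (swapTail σ) * e σ
    reflect σ = begin
      - (sgn (swapTail σ) * y (swapTail σ) * e (swapTail (swapTail σ)))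
        ≈⟨ -‿cong (*-cong (*-congʳ (sgn-swapTail σ)) (reflexive (≡.cong e (swapTail-involutive σ)))) ⟩
      - (- sgn σ * y (swapTail σ) * e σ)
        ≈⟨ -‿cong (*-congʳ (-‿distribˡ-* (sgn σ) _)) ⟨
      - (- (sgn σ * y (swapTail σ)) * e σ)
        ≈⟨ -‿cong (-‿distribˡ-* _ (e σ)) ⟨
      - - (sgn σ * y (swapTail σ) * e σ)
        ≈⟨ -‿involutive _ ⟩
      sgn σ * y (swapTail σ) * e σ ∎

  RNAP⊥⇔TailAntisymmetric : ∀ v → InRNAP⊥ v ⇔ TailAntisymmetric (v L)
  RNAP⊥⇔TailAntisymmetric v = mk⇔ ⊥⇒anti anti⇒⊥
    where
    ⊥⇒anti : InRNAP⊥ v → TailAntisymmetric (v L)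
    ⊥⇒anti v⊥ σ = sgn-cancel σ (begin
      sgn σ * (v L σ + v L (swapTail σ))
        ≈⟨ ΣS3-δ (λ τ → sgn τ * (v L τ + v L (swapTail τ))) σ ⟨
      ΣS3 (λ τ → sgn τ * (v L τ + v L (swapTail τ)) * δ τ σ)
        ≈⟨ ⟨napCombination⟩ (λ τ → δ τ σ) v ⟨
      ⟨ napCombination (λ τ → δ τ σ) , v ⟩
        ≈⟨ v⊥ _ ((λ τ → δ τ σ) , λ _ _ → refl) ⟩
      0# ∎)
    anti⇒⊥ : TailAntisymmetric (v L) → InRNAP⊥ v
    anti⇒⊥ anti w (e , w≈) = begin
      ⟨ w , v ⟩                  ≈⟨ ⟨⟩-congˡ v w≈ ⟩
      ⟨ napCombination e , v ⟩   ≈⟨ ⟨napCombination⟩ e v ⟩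
      ΣS3 (λ σ → sgn σ * (v L σ + v L (swapTail σ)) * e σ)
        ≈⟨ ΣS3-zero (λ σ → trans (*-congʳ (trans (*-congˡ (anti σ)) (zeroʳ (sgn σ)))) (zeroˡ (e σ))) ⟩
      0#                         ∎

  RPAN⇔TailAntisymmetric : ∀ v → InRPAN v ⇔ TailAntisymmetric (v L)
  RPAN⇔TailAntisymmetric v = mk⇔ pan⇒anti anti⇒pan
    where
    pan⇒anti : InRPAN v → TailAntisymmetric (v L)
    pan⇒anti (a , b , v≈) = TailAntisymmetric-resp
      (λ σ → trans (v≈ L σ) (panCombination-L a b σ)) (tailDifference-antisymmetric b)
    anti⇒pan : TailAntisymmetric (v L) → InRPAN v
    anti⇒pan anti = v R , evenPart (v L) , v≈
      where
      v≈ : v ≈V panCombination (v R) (evenPart (v L))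
      v≈ L σ = trans (antisymmetric⇒evenPart-difference anti σ)
                     (sym (panCombination-L (v R) (evenPart (v L)) σ))
      v≈ R σ = sym (panCombination-R (v R) (evenPart (v L)) σ)

proposition2p5p1 : ∀ {c ℓ : Level} (F : Field c ℓ) (v : Quadratic.V3 F) →
    Quadratic.InRPAN F v ⇔ Quadratic.InRNAP⊥ F v
proposition2p5p1 F v = ⇔.trans (RPAN⇔TailAntisymmetric F v) (⇔.sym (RNAP⊥⇔TailAntisymmetric F v))
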